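{- Let $U$ be a finite set and $g:\mathcal{F}\to\mathbf{Z}$ an intersecting-supermodular function on $U$ with $|Z|\geq g(Z)$ for every $Z\in\mathcal{F}$, and let $K$ be any partial transversal of $\mathcal{P}[g]$, with $g_{K}$ the reduction of $g$ by $K$. Then for every $u\in U\setminus K$: if $P[g](u)\cap K=\emptyset$ then $d[g_{K}](u)=d[g](u)$, and if $P[g](u)\cap K\neq\emptyset$ then $d[g_{K}](u)<d[g](u)$.
   Context: Two sets $X,Y\subseteq U$ are intersecting if none of $X\cap Y$, $X\setminus Y$, $Y\setminus X$ is empty. A family $\mathcal{F}\subseteq 2^{U}$ is an intersecting family if every intersecting pair $X,Y\in\mathcal{F}$ satisfies $X\cup Y, X\cap Y\in\mathcal{F}$. A function $g:\mathcal{F}\to\mathbf{Z}$ is intersecting-supermodular if $\mathcal{F}$ is an intersecting family and $g(X)+g(Y)\leq g(X\cup Y)+g(X\cap Y)$ for every intersecting pair $X,Y\in\mathcal{F}$. For any such $g$ (on any ground set), $\mathcal{E}[g]:=\{X\in\mathcal{F}\mid g(X)\geq 2,\ \text{there is no } X'\in\mathcal{F} \text{ with } X'\subsetneq X,\ g(X')\geq g(X)\}$ and $d[g](u)=\max\{1,\max\{g(X)\mid u\in X\in\mathcal{E}[g]\}\}$ (inner maximum $-\infty$ if empty). $\mathcal{P}[g]$ consists of the maximal members of $\mathcal{E}[g]$ together with the singletons $\{u\}$ for $u$ in no member of $\mathcal{E}[g]$; it is a partition of the ground set, and $P[g](u)$ is the part containing $u$. A set $K\subseteq U$ is a partial transversal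 of $\mathcal{P}[g]$ if $|K\cap P|\leq 1$ for every $P\in\mathcal{P}[g]$. The reduction of $g$ by $K$ is $g_{K}:\mathcal{F}_{K}\to\mathbf{Z}$, an intersecting-supermodular function on $U\setminus K$, with $\mathcal{F}_{K}=\{Z\setminus K\mid Z\in\mathcal{F}\}$ and $g_{K}(X)=\max\{\hat{g}_{K}(Z)\mid Z\in\mathcal{F},\ Z\setminus K=X\}$, where $\hat{g}_{K}(Z)=g(Z)-1$ if $Z\cap K\neq\emptyset$ and $\hat{g}_{K}(Z)=g(Z)$ otherwise; $d[g_{K}]$ is defined from $g_{K}$ in the same way as $d[g]$ from $g$. -}

module Defs where

open import Data.Nat as ℕ using (ℕ; zero; suc)
open import Data.Bool using (Bool; true; false; _∧_; not; if_then_else_)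
open import Data.Fin using (Fin)
open import Data.Fin.Subset
open import Data.Fin.Subset.Properties using (_⊂?_; _∈?_)
open import Data.Integer as ℤ using (ℤ; +_; _⊔_)
open import Data.List using (List; []; _∷_; map; _++_; filterᵇ; foldr)
open import Data.Bool.ListAction using (and; or)
open import Data.Maybe using (Maybe; just; nothing; maybe)
open import Data.Vec using (Vec; []; _∷_)
open import Data.Vec.Properties using (≡-dec)
import Data.Bool.Properties as BoolP
open import Relation.Nullary.Decidable using (⌊_⌋; Dec; yes; no)
open import Relation.Nullary using (¬_)
open import Data.Product using (_×_; ∃)
open import Data.Sum using (_⊎_)
open import Function using (id; _∘_)
open import Relation.Binary.PropositionalEquality using (_≡_)

-- Ground set U = Fin n; subsets of U are 'Subset n' (Data.Fin.Subset).
-- A family F ⊆ 2^U is given by its (Boolean) indicator on 2^U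
-- (U is finite, so every family is decidable).
-- A function g : F → ℤ is given as a total function Subset n → ℤ whose
-- values outside F are irrelevant (all notions below only use g on F).

Family : ℕ → Set
Family n = Subset n → Bool

allSubsets : ∀ n → List (Subset n)
allSubsets zero    = [] ∷ []
allSubsets (suc n) = map (outside ∷_) (allSubsets n) ++ map (inside ∷_) (allSubsets n)

_≟ˢ_ : ∀ {n} (X Y : Subset n) → Dec (X ≡ Y)
_≟ˢ_ = ≡-dec BoolP._≟_

Intersecting : ∀ {n} → Subset n → Subset n → Set
Intersecting X Y = Nonempty (X ∩ Y) × Nonempty (X ─ Y) × Nonempty (Y ─ X)

IsIntersectingFamily : ∀ {n} → Family n → Set
IsIntersectingFamily {n} F =
  ∀ (X Y : Subset n) → F X ≡ true → F Y ≡ true → Intersecting X Y →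
  F (X ∪ Y) ≡ true × F (X ∩ Y) ≡ true

IsIntersectingSupermodular : ∀ {n} → Family n → (Subset n → ℤ) → Set
IsIntersectingSupermodular {n} F g =
  IsIntersectingFamily F ×
  (∀ (X Y : Subset n) → F X ≡ true → F Y ≡ true → Intersecting X Y →
     g X ℤ.+ g Y ℤ.≤ g (X ∪ Y) ℤ.+ g (X ∩ Y))

inE : ∀ {n} → Family n → (Subset n → ℤ) → Subset n → Bool
inE {n} F g X =
  F X ∧ ⌊ + 2 ℤ.≤? g X ⌋ ∧
  and (map (λ X' → not (F X' ∧ ⌊ X' ⊂? X ⌋ ∧ ⌊ g X ℤ.≤? g X' ⌋)) (allSubsets n))

maxℤ : List ℤ → Maybe ℤ
maxℤ = foldr (λ x m → just (maybe (x ⊔_) x m)) nothing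

d : ∀ {n} → Family n → (Subset n → ℤ) → Fin n → ℤ
d {n} F g u =
  maybe (λ m → + 1 ⊔ m) (+ 1)
    (maxℤ (map g (filterᵇ (λ X → inE F g X ∧ ⌊ u ∈? X ⌋) (allSubsets n))))

IsPart : ∀ {n} → Family n → (Subset n → ℤ) → Subset n → Set
IsPart {n} F g P =
  (inE F g P ≡ true × (∀ (Q : Subset n) → inE F g Q ≡ true → ¬ (P ⊂ Q)))
  ⊎ ∃ (λ (v : Fin n) → P ≡ ⁅ v ⁆ × (∀ (X : Subset n) → inE F g X ≡ true → v ∉ X))

IsPartialTransversal : ∀ {n} → Family n → (Subset n → ℤ) → Subset n → Set
IsPartialTransversal {n} F g K =
  ∀ (P : Subset n) → IsPart F g P → ∣ K ∩ P ∣ ℕ.≤ 1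

-- Reduction of g by K.  The ground set of g_K is U ∖ K; its subsets are
-- represented as subsets of U disjoint from K (every member of ℱ_K is of
-- the form Z ∖ K, hence disjoint from K).

ĝ : ∀ {n} → (Subset n → ℤ) → Subset n → Subset n → ℤ
ĝ g K Z = if ⌊ (Z ∩ K) ≟ˢ ⊥ ⌋ then g Z else g Z ℤ.- + 1

FK : ∀ {n} → Family n → Subset n → Family n
FK {n} F K X = or (map (λ Z → F Z ∧ ⌊ (Z ─ K) ≟ˢ X ⌋) (allSubsets n))

-- g_K(X) = max{ĝ_K(Z) | Z ∈ ℱ, Z ∖ K = X}  (for X ∈ ℱ_K; value 0 elsewhere, irrelevant).
gK : ∀ {n} → Family n → (Subset n → ℤ) → Subset n → Subset n → ℤ
gK {n} F g K X =
  maybe id (+ 0)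
    (maxℤ (map (ĝ g K) (filterᵇ (λ Z → F Z ∧ ⌊ (Z ─ K) ≟ˢ X ⌋) (allSubsets n))))

module Submission where

-- Write ℰ for ℰ[g] and ℰ_K for ℰ[g_K].
--   * Descent: every Z ∈ F with g(Z) ≥ 2 contains a member of ℰ of at least
--     the same value; every member of ℰ lies in a maximal one.
--   * Laminarity (uses supermodularity): a member of ℰ meeting a maximal
--     member P of ℰ is contained in P.
--   * Lifting: every X ∈ ℰ_K lies in some W ∈ ℰ with g_K(X) ≤ g(W),
--     strictly if W meets K.
--   * Restriction: if a maximal P ∈ ℰ avoids K, every X ∈ ℰ inside P is in
--     ℰ_K with g(X) ≤ g_K(X); this uses |Z| ≥ g(Z) and that K meets each
--     maximal member of ℰ at most once.
-- Lifting gives d[g_K] ≤ d[g]; restriction gives the converse when the part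
-- of u avoids K; when that part meets K, lifting plus laminarity make the
-- inequality strict.

open import Defs
open import Data.Bool using (Bool; true; false; T; T?; not; _∧_)
import Data.Bool.Properties as Bool
open import Data.Bool.Properties using (T-≡; T-∧)
open import Data.Empty using (⊥-elim)
import Data.Empty as Empty
open import Data.Fin using (Fin)
open import Data.Fin.Subset
  using (Subset; outside; inside; ⊥; _∩_; _∪_; _─_; _∈_; _∉_; _⊆_; _⊂_; _⊃_; ∣_∣; Empty; Nonempty)
open import Data.Fin.Subset.Properties
  using ( _∈?_; _⊂?_; nonempty?; anySubset?; Empty-unique; ∉⊥; ⊆-refl; ⊆-trans; ⊆-antisym
        ; ⊆-⊂-trans; p⊂q⇒p⊆q; p⊆q⇒∣p∣≤∣q∣; x∈p∩q⁺; x∈p∩q⁻; x∈p∪q⁻; p⊆p∪q; q⊆p∪q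
        ; x∈p∧x∉q⇒x∈p─q; p─q⊆p; x∈⁅y⁆⇒x≡y )
open import Data.Fin.Subset.Induction using (Acc; acc; ⊂-wellFounded; ⊃-wellFounded)
open import Data.Integer using (ℤ; +_; _≤_; _<_; _-_; _⊔_; _≤?_; +<+)
import Data.Integer as ℤ
open import Data.Integer.Properties
  using ( ≤-refl; ≤-reflexive; ≤-trans; ≤-antisym; <-≤-trans; ≤-<-trans; <-trans; <⇒≤; <⇒≱
        ; ≰⇒>; <-irrefl; ⊔-sel; i≤i⊔j; i≤j⊔i; +-comm; +-mono-≤-<; +-monoˡ-≤; i≤pred[j]⇒i<j
        ; drop‿+<+; module ≤-Reasoning )
open import Data.List using (List; []; _∷_; map; filterᵇ)
open import Data.List.Membership.Propositional using (find; lose) renaming (_∈_ to _∈ₗ_)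
open import Data.List.Membership.Propositional.Properties
  using (∈-map⁺; ∈-map⁻; ∈-++⁺ˡ; ∈-++⁺ʳ; ∈-filter⁺; ∈-filter⁻)
open import Data.List.Relation.Unary.All using (lookup; tabulate)
open import Data.List.Relation.Unary.All.Properties using (all⁺; all⁻)
open import Data.List.Relation.Unary.Any using (here; there)
open import Data.List.Relation.Unary.Any.Properties using (any⁺; any⁻)
open import Data.Maybe using (just; maybe)
open import Data.Nat using (ℕ)
import Data.Nat as ℕ
import Data.Nat.Properties as ℕₚ
open import Data.Product using (_×_; ∃-syntax; _,_; proj₁; proj₂)
open import Data.Sum using (_⊎_; inj₁; inj₂)
open import Data.Vec.Base using ([]; _∷_; here; there)
open import Function using (id; _∘_)
open import Function.Bundles using (Equivalence)
open import Relation.Binary.PropositionalEquality using (_≡_; _≢_; refl; sym; trans; cong; subst)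
open import Relation.Nullary using (¬_; Dec; yes; no)
open import Relation.Nullary.Decidable using (⌊_⌋; toWitness; fromWitness; map′; _×-dec_)

T⇒true : ∀ {b} → T b → b ≡ true
T⇒true = Equivalence.to T-≡

true⇒T : ∀ {b} → b ≡ true → T b
true⇒T = Equivalence.from T-≡

not∧∧ : ∀ {a b c} → T (not (a ∧ b ∧ c)) → T a → T b → ¬ T c
not∧∧ {true} {true} {true} ()
not∧∧ {false} _ ()
not∧∧ {true} {false} _ _ ()
not∧∧ {true} {true} {false} _ _ _ ()

∈-allSubsets : ∀ {n} (X : Subset n) → X ∈ₗ allSubsets n
∈-allSubsets [] = here refl
∈-allSubsets {ℕ.suc n} (outside ∷ X) = ∈-++⁺ˡ (∈-map⁺ (outside ∷_) (∈-allSubsets X))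
∈-allSubsets {ℕ.suc n} (inside ∷ X) =
  ∈-++⁺ʳ (map (outside ∷_) (allSubsets n)) (∈-map⁺ (inside ∷_) (∈-allSubsets X))

IsGreatest : List ℤ → ℤ → Set
IsGreatest xs m = m ∈ₗ xs × (∀ {x} → x ∈ₗ xs → x ≤ m)

greatest-∷ : ∀ x {xs m} → IsGreatest xs m → IsGreatest (x ∷ xs) (x ⊔ m)
greatest-∷ x {m = m} (m∈xs , below-m) = member (⊔-sel x m) , below
  where
  member : x ⊔ m ≡ x ⊎ x ⊔ m ≡ m → x ⊔ m ∈ₗ x ∷ _
  member (inj₁ is-x) = here is-x
  member (inj₂ is-m) = there (subst (_∈ₗ _) (sym is-m) m∈xs)
  below : ∀ {y} → y ∈ₗ x ∷ _ → y ≤ x ⊔ m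
  below (here refl) = i≤i⊔j x m
  below (there y∈xs) = ≤-trans (below-m y∈xs) (i≤j⊔i x m)

maxℤ-greatest : ∀ xs {m} → maxℤ xs ≡ just m → IsGreatest xs m
maxℤ-greatest (x ∷ []) refl = here refl , λ { (here refl) → ≤-refl }
maxℤ-greatest (x ∷ y ∷ ys) refl = greatest-∷ x (maxℤ-greatest (y ∷ ys) refl)

maxOr0-greatest : ∀ {x} xs → x ∈ₗ xs → IsGreatest xs (maybe id (+ 0) (maxℤ xs))
maxOr0-greatest (y ∷ ys) _ = maxℤ-greatest (y ∷ ys) refl

x∈p─q⁻ : ∀ {n} (p q : Subset n) {x} → x ∈ p ─ q → x ∈ p × x ∉ q
x∈p─q⁻ p q x∈p─q = p─q⊆p p q x∈p─q , not-in-q p q x∈p─q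
  where
  not-in-q : ∀ {n} (p q : Subset n) {x} → x ∈ p ─ q → x ∉ q
  not-in-q (_ ∷ p) (outside ∷ q) here ()
  not-in-q (_ ∷ p) (_ ∷ q) (there x∈p─q) (there x∈q) = not-in-q p q x∈p─q x∈q

─-empty⇒⊆ : ∀ {n} {p q : Subset n} → Empty (p ─ q) → p ⊆ q
─-empty⇒⊆ {q = q} p─q-empty {x} x∈p with x ∈? q
... | yes x∈q = x∈q
... | no x∉q = ⊥-elim (p─q-empty (x , x∈p∧x∉q⇒x∈p─q x∈p x∉q))

⊆∧─⇒⊂ : ∀ {n} {p q : Subset n} → p ⊆ q → Nonempty (q ─ p) → p ⊂ q
⊆∧─⇒⊂ {p = p} {q} p⊆q (x , x∈q─p) = p⊆q , x , x∈p─q⁻ q p x∈q─p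

⊆⇒⊂⊎≡ : ∀ {n} {p q : Subset n} → p ⊆ q → p ⊂ q ⊎ p ≡ q
⊆⇒⊂⊎≡ {p = p} {q} p⊆q with nonempty? (q ─ p)
... | yes q─p≠∅ = inj₁ (⊆∧─⇒⊂ p⊆q q─p≠∅)
... | no q─p=∅ = inj₂ (⊆-antisym p⊆q (─-empty⇒⊆ q─p=∅))

meeting-trichotomy : ∀ {n} {p q : Subset n} → Nonempty (p ∩ q) → p ⊆ q ⊎ q ⊂ p ⊎ Intersecting p q
meeting-trichotomy {p = p} {q} p∩q≠∅ with nonempty? (p ─ q) | nonempty? (q ─ p)
... | no p─q=∅ | _ = inj₁ (─-empty⇒⊆ p─q=∅)
... | yes p─q≠∅ | no q─p=∅ = inj₂ (inj₁ (⊆∧─⇒⊂ (─-empty⇒⊆ q─p=∅) p─q≠∅))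
... | yes p─q≠∅ | yes q─p≠∅ = inj₂ (inj₂ (p∩q≠∅ , p─q≠∅ , q─p≠∅))

⊂-∪ : ∀ {n} (p q : Subset n) → Nonempty (p ─ q) → q ⊂ p ∪ q
⊂-∪ p q (x , x∈p─q) =
  q⊆p∪q p q , x , p⊆p∪q q (proj₁ (x∈p─q⁻ p q x∈p─q)) , proj₂ (x∈p─q⁻ p q x∈p─q)

∩-⊂ʳ : ∀ {n} (p q : Subset n) → Nonempty (q ─ p) → p ∩ q ⊂ q
∩-⊂ʳ p q (x , x∈q─p) =
  (λ y∈p∩q → proj₂ (x∈p∩q⁻ p q y∈p∩q)) , x , proj₁ (x∈p─q⁻ q p x∈q─p) ,
  λ x∈p∩q → proj₂ (x∈p─q⁻ q p x∈q─p) (proj₁ (x∈p∩q⁻ p q x∈p∩q))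

∩-⊂ˡ : ∀ {n} (p q : Subset n) → Nonempty (p ─ q) → p ∩ q ⊂ p
∩-⊂ˡ p q (x , x∈p─q) =
  (λ y∈p∩q → proj₁ (x∈p∩q⁻ p q y∈p∩q)) , x , proj₁ (x∈p─q⁻ p q x∈p─q) ,
  λ x∈p∩q → proj₂ (x∈p─q⁻ p q x∈p─q) (proj₂ (x∈p∩q⁻ p q x∈p∩q))

⊆-─ : ∀ {n} {p q k : Subset n} → p ⊆ q → Empty (p ∩ k) → p ⊆ q ─ k
⊆-─ p⊆q p∩k=∅ {x} x∈p =
  x∈p∧x∉q⇒x∈p─q (p⊆q x∈p) (λ x∈k → p∩k=∅ (x , x∈p∩q⁺ (x∈p , x∈k)))

⊆-∪-disjoint : ∀ {n} {p q r : Subset n} → p ⊆ q ∪ r → Empty (p ∩ r) → p ⊆ q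
⊆-∪-disjoint {q = q} {r} p⊆q∪r p∩r=∅ {x} x∈p with x∈p∪q⁻ q r (p⊆q∪r x∈p)
... | inj₁ x∈q = x∈q
... | inj₂ x∈r = ⊥-elim (p∩r=∅ (x , x∈p∩q⁺ (x∈p , x∈r)))

∪-⊆ : ∀ {n} {p q r : Subset n} → p ⊆ r → q ⊆ r → p ∪ q ⊆ r
∪-⊆ {p = p} {q} p⊆r q⊆r x∈p∪q with x∈p∪q⁻ p q x∈p∪q
... | inj₁ x∈p = p⊆r x∈p
... | inj₂ x∈q = q⊆r x∈q

∩-monoˡ : ∀ {n} {p q : Subset n} (r : Subset n) → p ⊆ q → p ∩ r ⊆ q ∩ r
∩-monoˡ {p = p} r p⊆q x∈p∩r = x∈p∩q⁺ (p⊆q (proj₁ (x∈p∩q⁻ p r x∈p∩r)) , proj₂ (x∈p∩q⁻ p r x∈p∩r))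

─-monoˡ : ∀ {n} {p q : Subset n} (k : Subset n) → p ⊆ q → p ─ k ⊆ q ─ k
─-monoˡ {p = p} k p⊆q x∈p─k =
  x∈p∧x∉q⇒x∈p─q (p⊆q (proj₁ (x∈p─q⁻ p k x∈p─k))) (proj₂ (x∈p─q⁻ p k x∈p─k))

─-disjoint : ∀ {n} {p k : Subset n} → Empty (p ∩ k) → p ─ k ≡ p
─-disjoint {p = p} {k} p∩k=∅ = ⊆-antisym (p─q⊆p p k) (⊆-─ ⊆-refl p∩k=∅)

pred< : ∀ x → x - + 1 < x
pred< x = i≤pred[j]⇒i<j (≤-reflexive (+-comm x _))

-- Members of ℰ[g], descent, maximal members, the parts of 𝒫[g] and d[g],
-- for an arbitrary g : F → ℤ (no supermodularity needed).  Instantiated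
-- both for g and for g_K.
module Critical {n : ℕ} (F : Family n) (g : Subset n → ℤ) where

  record InE (X : Subset n) : Set where
    field
      member   : F X ≡ true
      atLeast2 : + 2 ≤ g X
      minimal  : ∀ Y → F Y ≡ true → Y ⊂ X → g Y < g X
  open InE public

  NoBetterSubset : Subset n → Subset n → Bool
  NoBetterSubset X Y = not (F Y ∧ ⌊ Y ⊂? X ⌋ ∧ ⌊ g X ≤? g Y ⌋)

  inE-sound : ∀ {X} → inE F g X ≡ true → InE X
  inE-sound {X} inE-X with F X in fX | + 2 ≤? g X
  ... | true | yes 2≤gX = record { member = fX ; atLeast2 = 2≤gX ; minimal = minimal′ }
    where
    noBetter : ∀ {Y} → Y ∈ₗ allSubsets n → T (NoBetterSubset X Y)
    noBetter = lookup (all⁺ (NoBetterSubset X) (allSubsets n) (true⇒T inE-X))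
    minimal′ : ∀ Y → F Y ≡ true → Y ⊂ X → g Y < g X
    minimal′ Y fY Y⊂X =
      ≰⇒> (not∧∧ (noBetter (∈-allSubsets Y)) (true⇒T fY) (fromWitness {a? = Y ⊂? X} Y⊂X)
             ∘ fromWitness {a? = g X ≤? g Y})
  inE-sound () | true | no _
  inE-sound () | false | _

  inE-complete : ∀ {X} → InE X → inE F g X ≡ true
  inE-complete {X} eX rewrite member eX with + 2 ≤? g X
  ... | yes _ =
    T⇒true (all⁻ (NoBetterSubset X) {xs = allSubsets n} (tabulate (λ {Y} _ → noBetter Y)))
    where
    noBetter : ∀ Y → T (NoBetterSubset X Y)
    noBetter Y with F Y in fY | Y ⊂? X | g X ≤? g Y
    ... | true  | yes Y⊂X | yes gX≤gY = <⇒≱ (minimal eX Y fY Y⊂X) gX≤gY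
    ... | true  | yes _   | no _      = _
    ... | true  | no _    | _         = _
    ... | false | _       | _         = _
  ... | no 2≰gX = ⊥-elim (2≰gX (atLeast2 eX))

  InE? : ∀ X → Dec (InE X)
  InE? X = map′ inE-sound inE-complete (inE F g X Bool.≟ true)

  InE-⊆-≤ : ∀ {X W} → InE X → F W ≡ true → W ⊆ X → g W ≤ g X
  InE-⊆-≤ eX fW W⊆X with ⊆⇒⊂⊎≡ W⊆X
  ... | inj₁ W⊂X = <⇒≤ (minimal eX _ fW W⊂X)
  ... | inj₂ refl = ≤-refl

  descend : ∀ Z → F Z ≡ true → + 2 ≤ g Z → ∃[ W ] InE W × W ⊆ Z × g Z ≤ g W
  descend Z = go Z (⊂-wellFounded Z)
    where
    go : ∀ Z → Acc _⊂_ Z → F Z ≡ true → + 2 ≤ g Z → ∃[ W ] InE W × W ⊆ Z × g Z ≤ g W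
    go Z (acc smaller) fZ 2≤gZ
      with anySubset? (λ Y → (F Y Bool.≟ true) ×-dec (Y ⊂? Z) ×-dec (g Z ≤? g Y))
    ... | yes (Y , fY , Y⊂Z , gZ≤gY) with go Y (smaller Y⊂Z) fY (≤-trans 2≤gZ gZ≤gY)
    ...   | W , eW , W⊆Y , gY≤gW = W , eW , ⊆-trans W⊆Y (p⊂q⇒p⊆q Y⊂Z) , ≤-trans gZ≤gY gY≤gW
    go Z _ fZ 2≤gZ | no noBetter = Z , eZ , ⊆-refl , ≤-refl
      where
      eZ : InE Z
      eZ = record { member = fZ ; atLeast2 = 2≤gZ
                  ; minimal = λ Y fY Y⊂Z → ≰⇒> (λ gZ≤gY → noBetter (Y , fY , Y⊂Z , gZ≤gY)) }

  Maximal : Subset n → Set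
  Maximal P = ∀ R → InE R → ¬ (P ⊂ R)

  MaxE : Subset n → Set
  MaxE P = InE P × Maximal P

  extend : ∀ W → InE W → ∃[ Q ] MaxE Q × W ⊆ Q
  extend W = go W (⊃-wellFounded W)
    where
    go : ∀ W → Acc _⊃_ W → InE W → ∃[ Q ] MaxE Q × W ⊆ Q
    go W (acc larger) eW with anySubset? (λ R → InE? R ×-dec (W ⊂? R))
    ... | yes (R , eR , W⊂R) with go R (larger W⊂R) eR
    ...   | Q , maxQ , R⊆Q = Q , maxQ , ⊆-trans (p⊂q⇒p⊆q W⊂R) R⊆Q
    go W _ eW | no noLarger = W , (eW , λ R eR W⊂R → noLarger (R , eR , W⊂R)) , ⊆-refl

  part-meeting-E : ∀ {P X u} → IsPart F g P → u ∈ P → InE X → u ∈ X → MaxE P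
  part-meeting-E (inj₁ (eP , maxP)) _ _ _ = inE-sound eP , λ R eR → maxP R (inE-complete eR)
  part-meeting-E (inj₂ (v , refl , uncovered)) u∈P eX u∈X =
    ⊥-elim (uncovered _ (inE-complete eX) (subst (_∈ _) (x∈⁅y⁆⇒x≡y v u∈P) u∈X))

  part-two-points : ∀ {P x y} → IsPart F g P → x ∈ P → y ∈ P → x ≢ y → MaxE P
  part-two-points (inj₁ (eP , maxP)) _ _ _ = inE-sound eP , λ R eR → maxP R (inE-complete eR)
  part-two-points (inj₂ (v , refl , _)) x∈P y∈P x≢y =
    ⊥-elim (x≢y (trans (x∈⁅y⁆⇒x≡y v x∈P) (sym (x∈⁅y⁆⇒x≡y v y∈P))))

  valuesAt : Fin n → List ℤ
  valuesAt u = map g (filterᵇ (λ X → inE F g X ∧ ⌊ u ∈? X ⌋) (allSubsets n))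

  d-greatest : ∀ u → IsGreatest (+ 1 ∷ valuesAt u) (d F g u)
  d-greatest u = maxℤ-greatest (+ 1 ∷ valuesAt u) refl

  d-≥1 : ∀ u → + 1 ≤ d F g u
  d-≥1 u = proj₂ (d-greatest u) (here refl)

  d-≥ : ∀ {u X} → InE X → u ∈ X → g X ≤ d F g u
  d-≥ {u} {X} eX u∈X = proj₂ (d-greatest u) (there (∈-map⁺ g X-counted))
    where
    X-counted : X ∈ₗ filterᵇ (λ Y → inE F g Y ∧ ⌊ u ∈? Y ⌋) (allSubsets n)
    X-counted = ∈-filter⁺ (T? ∘ _) (∈-allSubsets X)
      (Equivalence.from T-∧ (true⇒T (inE-complete eX) , fromWitness u∈X))

  d-attained : ∀ u → d F g u ≡ + 1 ⊎ ∃[ X ] InE X × u ∈ X × d F g u ≡ g X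
  d-attained u with proj₁ (d-greatest u)
  ... | here d≡1 = inj₁ d≡1
  ... | there d∈values with ∈-map⁻ g d∈values
  ...   | X , X∈filtered , d≡gX
    with Equivalence.to T-∧ (proj₂ (∈-filter⁻ (T? ∘ _) {xs = allSubsets n} X∈filtered))
  ...     | inE-X , u∈?X = inj₂ (X , inE-sound (T⇒true inE-X) , toWitness u∈?X , d≡gX)

module Laminarity {n : ℕ} (F : Family n) (g : Subset n → ℤ)
                  (sm : IsIntersectingSupermodular F g) where
  open Critical F g

  ∪-closed : ∀ {X Y} → F X ≡ true → F Y ≡ true → Intersecting X Y → F (X ∪ Y) ≡ true
  ∪-closed fX fY XY = proj₁ (proj₁ sm _ _ fX fY XY)

  ∩-closed : ∀ {X Y} → F X ≡ true → F Y ≡ true → Intersecting X Y → F (X ∩ Y) ≡ true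
  ∩-closed fX fY XY = proj₂ (proj₁ sm _ _ fX fY XY)

  gainˡ : ∀ {X Y} → F X ≡ true → F Y ≡ true → Intersecting X Y →
          g (X ∩ Y) < g Y → g X < g (X ∪ Y)
  gainˡ {X} {Y} fX fY XY loss =
    ≰⇒> λ gX∪Y≤gX → <⇒≱ (+-mono-≤-< gX∪Y≤gX loss) (proj₂ sm X Y fX fY XY)

  gainʳ : ∀ {X Y} → F X ≡ true → F Y ≡ true → Intersecting X Y →
          g (X ∩ Y) < g X → g Y < g (X ∪ Y)
  gainʳ {X} {Y} fX fY XY loss =
    ≰⇒> λ gX∪Y≤gY → <⇒≱ (+-mono-≤-< gX∪Y≤gY loss)
      (subst (_≤ g (X ∪ Y) ℤ.+ g (X ∩ Y)) (+-comm (g X) (g Y)) (proj₂ sm X Y fX fY XY))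

  module _ {P X : Subset n} (maxP : MaxE P) (eX : InE X) where
    private
      eP : InE P
      eP = proj₁ maxP

    -- No member Y of F with P ⊂ Y ⊆ X ∪ P is worth more than both P and X.
    -- By ⊂-induction: a member W of ℰ below Y of at least its value must
    -- cross P, and then W ∪ P is a smaller such set.
    no-rising-set : ∀ Y → Acc _⊂_ Y → F Y ≡ true → P ⊂ Y → Y ⊆ X ∪ P →
                    g P < g Y → ¬ (g X < g Y)
    no-rising-set Y (acc smaller) fY P⊂Y Y⊆X∪P gP<gY gX<gY
      with descend Y fY (≤-trans (atLeast2 eP) (<⇒≤ gP<gY))
    ... | W , eW , W⊆Y , gY≤gW with nonempty? (W ∩ P)
    ...   | no W∩P=∅ = <⇒≱ (<-≤-trans gX<gY gY≤gW)
                          (InE-⊆-≤ eX (member eW) (⊆-∪-disjoint (⊆-trans W⊆Y Y⊆X∪P) W∩P=∅))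
    ...   | yes W∩P≠∅ with meeting-trichotomy W∩P≠∅
    ...     | inj₁ W⊆P = <⇒≱ (<-≤-trans gP<gY gY≤gW) (InE-⊆-≤ eP (member eW) W⊆P)
    ...     | inj₂ (inj₁ P⊂W) = proj₂ maxP W eW P⊂W
    ...     | inj₂ (inj₂ WP@(_ , W─P≠∅ , P─W≠∅)) = smaller-or-equal (⊆⇒⊂⊎≡ (∪-⊆ W⊆Y (p⊂q⇒p⊆q P⊂Y)))
      where
      gY<gW∪P : g Y < g (W ∪ P)
      gY<gW∪P = ≤-<-trans gY≤gW (gainˡ (member eW) (member eP) WP
        (minimal eP _ (∩-closed (member eW) (member eP) WP) (∩-⊂ʳ W P P─W≠∅)))
      smaller-or-equal : W ∪ P ⊂ Y ⊎ W ∪ P ≡ Y → Empty.⊥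
      smaller-or-equal (inj₁ W∪P⊂Y) =
        no-rising-set (W ∪ P) (smaller W∪P⊂Y) (∪-closed (member eW) (member eP) WP)
          (⊂-∪ W P W─P≠∅) (⊆-trans (p⊂q⇒p⊆q W∪P⊂Y) Y⊆X∪P)
          (<-trans gP<gY gY<gW∪P) (<-trans gX<gY gY<gW∪P)
      smaller-or-equal (inj₂ W∪P≡Y) = <-irrefl (cong g (sym W∪P≡Y)) gY<gW∪P

    laminar : Nonempty (X ∩ P) → X ⊆ P
    laminar X∩P≠∅ with meeting-trichotomy X∩P≠∅
    ... | inj₁ X⊆P = X⊆P
    ... | inj₂ (inj₁ P⊂X) = ⊥-elim (proj₂ maxP X eX P⊂X)
    ... | inj₂ (inj₂ XP@(_ , X─P≠∅ , P─X≠∅)) =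
      ⊥-elim (no-rising-set (X ∪ P) (⊂-wellFounded _) (∪-closed fX fP XP) (⊂-∪ X P X─P≠∅) ⊆-refl
        (gainʳ fX fP XP (minimal eX _ fX∩P (∩-⊂ˡ X P X─P≠∅)))
        (gainˡ fX fP XP (minimal eP _ fX∩P (∩-⊂ʳ X P P─X≠∅))))
      where
      fX : F X ≡ true
      fX = member eX
      fP : F P ≡ true
      fP = member eP
      fX∩P : F (X ∩ P) ≡ true
      fX∩P = ∩-closed fX fP XP

module Reduction {n : ℕ} (F : Family n) (g : Subset n → ℤ) (K : Subset n) where

  ĝ-disjoint : ∀ {Z} → Empty (Z ∩ K) → ĝ g K Z ≡ g Z
  ĝ-disjoint {Z} Z∩K=∅ with (Z ∩ K) ≟ˢ ⊥
  ... | yes _ = refl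
  ... | no Z∩K≢⊥ = ⊥-elim (Z∩K≢⊥ (Empty-unique Z∩K=∅))

  ĝ-meeting : ∀ {Z} → Nonempty (Z ∩ K) → ĝ g K Z ≡ g Z - + 1
  ĝ-meeting {Z} (x , x∈Z∩K) with (Z ∩ K) ≟ˢ ⊥
  ... | yes Z∩K≡⊥ = ⊥-elim (∉⊥ (subst (x ∈_) Z∩K≡⊥ x∈Z∩K))
  ... | no _ = refl

  ĝ≤g : ∀ Z → ĝ g K Z ≤ g Z
  ĝ≤g Z with nonempty? (Z ∩ K)
  ... | yes Z∩K≠∅ = ≤-trans (≤-reflexive (ĝ-meeting Z∩K≠∅)) (<⇒≤ (pred< (g Z)))
  ... | no Z∩K=∅ = ≤-reflexive (ĝ-disjoint Z∩K=∅)

  ĝ-descent : ∀ {W Z} → W ⊆ Z → g Z ≤ g W → ĝ g K Z ≤ ĝ g K W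
  ĝ-descent {W} {Z} W⊆Z gZ≤gW with nonempty? (W ∩ K)
  ... | no W∩K=∅ = begin
    ĝ g K Z  ≤⟨ ĝ≤g Z ⟩
    g Z      ≤⟨ gZ≤gW ⟩
    g W      ≡⟨ ĝ-disjoint W∩K=∅ ⟨
    ĝ g K W  ∎
    where open ≤-Reasoning
  ... | yes W∩K≠∅@(x , x∈W∩K) = begin
    ĝ g K Z    ≡⟨ ĝ-meeting (x , ∩-monoˡ K W⊆Z x∈W∩K) ⟩
    g Z - + 1  ≤⟨ +-monoˡ-≤ (ℤ.- + 1) gZ≤gW ⟩
    g W - + 1  ≡⟨ ĝ-meeting W∩K≠∅ ⟨
    ĝ g K W    ∎
    where open ≤-Reasoning

  candidates : Subset n → List (Subset n)
  candidates X = filterᵇ (λ Z → F Z ∧ ⌊ (Z ─ K) ≟ˢ X ⌋) (allSubsets n)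

  ∈-candidates : ∀ {Z} → F Z ≡ true → Z ∈ₗ candidates (Z ─ K)
  ∈-candidates {Z} fZ = ∈-filter⁺ (T? ∘ _) (∈-allSubsets Z)
    (Equivalence.from T-∧ (true⇒T fZ , fromWitness {a? = (Z ─ K) ≟ˢ (Z ─ K)} refl))

  FK-member : ∀ {Z} → F Z ≡ true → FK F K (Z ─ K) ≡ true
  FK-member {Z} fZ = T⇒true (any⁺ _ (lose (∈-allSubsets Z)
    (Equivalence.from T-∧ (true⇒T fZ , fromWitness {a? = (Z ─ K) ≟ˢ (Z ─ K)} refl))))

  gᴷ-≥ : ∀ {Z} → F Z ≡ true → ĝ g K Z ≤ gK F g K (Z ─ K)
  gᴷ-≥ {Z} fZ = proj₂ (maxOr0-greatest (map (ĝ g K) (candidates (Z ─ K))) ĝZ∈) ĝZ∈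
    where
    ĝZ∈ : ĝ g K Z ∈ₗ map (ĝ g K) (candidates (Z ─ K))
    ĝZ∈ = ∈-map⁺ (ĝ g K) (∈-candidates fZ)

  gᴷ-attained : ∀ {X} → FK F K X ≡ true →
                ∃[ Z ] F Z ≡ true × Z ─ K ≡ X × gK F g K X ≡ ĝ g K Z
  gᴷ-attained {X} fᴷX with find (any⁻ _ (allSubsets n) (true⇒T fᴷX))
  ... | Z₀ , Z₀∈ , Z₀-selected
    with ∈-map⁻ (ĝ g K) (proj₁ (maxOr0-greatest (map (ĝ g K) (candidates X))
                                  (∈-map⁺ (ĝ g K) (∈-filter⁺ (T? ∘ _) Z₀∈ Z₀-selected))))
  ...   | Z , Z∈candidates , gᴷX≡ĝZ
    with Equivalence.to T-∧ (proj₂ (∈-filter⁻ (T? ∘ _) {xs = allSubsets n} Z∈candidates))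
  ...     | fZ , Z─K≟X = Z , T⇒true fZ , toWitness Z─K≟X , gᴷX≡ĝZ

module Proposition {n : ℕ} (F : Family n) (g : Subset n → ℤ)
    (sm : IsIntersectingSupermodular F g)
    (bounded : ∀ Z → F Z ≡ true → g Z ≤ + ∣ Z ∣)
    (K : Subset n) (transversal : IsPartialTransversal F g K) where

  open Critical F g
  open Laminarity F g sm
  open Reduction F g K
  module ℰᴷ = Critical (FK F K) (gK F g K)

  gᴷ : Subset n → ℤ
  gᴷ = gK F g K

  dᴷ : Fin n → ℤ
  dᴷ = d (FK F K) gᴷ

  -- A member W of ℰ with g(W) ≥ 3 has a point outside K: W has at least
  -- g(W) points, and lies in a maximal member of ℰ, which meets K at most once.
  escapes-K : ∀ {W} → InE W → + 2 < g W → Nonempty (W ─ K)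
  escapes-K {W} eW 2<gW with nonempty? (W ─ K)
  ... | yes W─K≠∅ = W─K≠∅
  ... | no W─K=∅ with extend W eW
  ...   | Q , (eQ , maxQ) , W⊆Q = ⊥-elim (ℕₚ.<⇒≱ 2<∣W∣ (ℕₚ.≤-trans ∣W∣≤1 (ℕₚ.n≤1+n 1)))
    where
    W⊆K∩Q : W ⊆ K ∩ Q
    W⊆K∩Q x∈W = x∈p∩q⁺ (─-empty⇒⊆ W─K=∅ x∈W , W⊆Q x∈W)
    ∣W∣≤1 : ∣ W ∣ ℕ.≤ 1
    ∣W∣≤1 = ℕₚ.≤-trans (p⊆q⇒∣p∣≤∣q∣ W⊆K∩Q)
              (transversal Q (inj₁ (inE-complete eQ , λ R eR → maxQ R (inE-sound eR))))
    2<∣W∣ : 2 ℕ.< ∣ W ∣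
    2<∣W∣ = drop‿+<+ (<-≤-trans 2<gW (bounded W (member eW)))

  -- Lifting: each X ∈ ℰ_K lies in a member W of ℰ with g_K(X) ≤ g(W),
  -- strictly if W meets K.  (W descends from a Z with Z ─ K = X attaining
  -- g_K(X); minimality of X in ℰ_K forces W ─ K = X.)
  lift : ∀ {X} → ℰᴷ.InE X →
         ∃[ W ] InE W × X ⊆ W × gᴷ X ≤ g W × (Nonempty (W ∩ K) → gᴷ X < g W)
  lift {X} eᴷX with gᴷ-attained (ℰᴷ.member eᴷX)
  ... | Z , fZ , refl , gᴷX≡ĝZ
    with descend Z fZ (≤-trans (ℰᴷ.atLeast2 eᴷX) (≤-trans (≤-reflexive gᴷX≡ĝZ) (ĝ≤g Z)))
  ...   | W , eW , W⊆Z , gZ≤gW = W , eW , X⊆W , ≤-trans gᴷX≤ĝW (ĝ≤g W) , strict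
    where
    gᴷX≤ĝW : gᴷ (Z ─ K) ≤ ĝ g K W
    gᴷX≤ĝW = ≤-trans (≤-reflexive gᴷX≡ĝZ) (ĝ-descent W⊆Z gZ≤gW)
    W─K≡X : W ─ K ≡ Z ─ K
    W─K≡X with ⊆⇒⊂⊎≡ (─-monoˡ K W⊆Z)
    ... | inj₁ W─K⊂X = ⊥-elim (<⇒≱ (ℰᴷ.minimal eᴷX _ (FK-member (member eW)) W─K⊂X)
                                    (≤-trans gᴷX≤ĝW (gᴷ-≥ (member eW))))
    ... | inj₂ W─K≡X = W─K≡X
    X⊆W : Z ─ K ⊆ W
    X⊆W x∈X = p─q⊆p W K (subst (_ ∈_) (sym W─K≡X) x∈X)
    strict : Nonempty (W ∩ K) → gᴷ (Z ─ K) < g W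
    strict W∩K≠∅ = ≤-<-trans gᴷX≤ĝW (subst (_< g W) (sym (ĝ-meeting W∩K≠∅)) (pred< (g W)))

  module _ {P X : Subset n} (maxP : MaxE P) (P∩K=∅ : Empty (P ∩ K))
           (eX : InE X) (X⊆P : X ⊆ P) where

    -- No Z ∈ F with Z ─ K ⊂ X has ĝ(Z) ≥ g(X).  Otherwise descend from Z to
    -- W ∈ ℰ: if W avoids K, then W ⊆ Z ─ K ⊂ X beats X; if W meets K, then
    -- g(W) ≥ 3, so W has a point of X ⊆ P outside K, and laminarity puts W
    -- inside P, which avoids K.
    no-large-piece : ∀ {Z} → F Z ≡ true → Z ─ K ⊂ X → ¬ (g X ≤ ĝ g K Z)
    no-large-piece {Z} fZ Z─K⊂X gX≤ĝZ
      with descend Z fZ (≤-trans (atLeast2 eX) (≤-trans gX≤ĝZ (ĝ≤g Z)))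
    ... | W , eW , W⊆Z , gZ≤gW with nonempty? (W ∩ K)
    ...   | no W∩K=∅ = <⇒≱ (minimal eX W (member eW) (⊆-⊂-trans (⊆-─ W⊆Z W∩K=∅) Z─K⊂X))
                          (≤-trans gX≤ĝW (≤-reflexive (ĝ-disjoint W∩K=∅)))
      where
      gX≤ĝW : g X ≤ ĝ g K W
      gX≤ĝW = ≤-trans gX≤ĝZ (ĝ-descent W⊆Z gZ≤gW)
    ...   | yes (x , x∈W∩K) = P∩K=∅ (x , ∩-monoˡ K W⊆P x∈W∩K)
      where
      gX<gW : g X < g W
      gX<gW = ≤-<-trans (≤-trans gX≤ĝZ (ĝ-descent W⊆Z gZ≤gW))
                (subst (_< g W) (sym (ĝ-meeting (x , x∈W∩K))) (pred< (g W)))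
      W⊆P : W ⊆ P
      W⊆P with escapes-K eW (≤-<-trans (atLeast2 eX) gX<gW)
      ... | y , y∈W─K = laminar maxP eW
        (y , x∈p∩q⁺ (p─q⊆p W K y∈W─K , X⊆P (p⊂q⇒p⊆q Z─K⊂X (─-monoˡ K W⊆Z y∈W─K))))

    restrict : ℰᴷ.InE X × g X ≤ gᴷ X
    restrict = eᴷX , gX≤gᴷX
      where
      X∩K=∅ : Empty (X ∩ K)
      X∩K=∅ (x , x∈X∩K) = P∩K=∅ (x , ∩-monoˡ K X⊆P x∈X∩K)
      X─K≡X : X ─ K ≡ X
      X─K≡X = ─-disjoint X∩K=∅
      gX≤gᴷX : g X ≤ gᴷ X
      gX≤gᴷX = subst (λ Y → g X ≤ gᴷ Y) X─K≡X
                 (subst (_≤ gᴷ (X ─ K)) (ĝ-disjoint X∩K=∅) (gᴷ-≥ (member eX)))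
      smaller-loses : ∀ X' → FK F K X' ≡ true → X' ⊂ X → gᴷ X' < gᴷ X
      smaller-loses X' fᴷX' X'⊂X with gᴷ-attained fᴷX'
      ... | Z , fZ , refl , gᴷX'≡ĝZ =
        ≤-<-trans (≤-reflexive gᴷX'≡ĝZ) (<-≤-trans (≰⇒> (no-large-piece fZ X'⊂X)) gX≤gᴷX)
      eᴷX : ℰᴷ.InE X
      eᴷX = record
        { member   = subst (λ Y → FK F K Y ≡ true) X─K≡X (FK-member (member eX))
        ; atLeast2 = ≤-trans (atLeast2 eX) gX≤gᴷX
        ; minimal  = smaller-loses
        }

  d-reduced≤d : ∀ u → dᴷ u ≤ d F g u
  d-reduced≤d u with ℰᴷ.d-attained u
  ... | inj₁ dᴷ≡1 = ≤-trans (≤-reflexive dᴷ≡1) (d-≥1 u)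
  ... | inj₂ (X , eᴷX , u∈X , dᴷ≡gᴷX) with lift eᴷX
  ...   | W , eW , X⊆W , gᴷX≤gW , _ = begin
    dᴷ u     ≡⟨ dᴷ≡gᴷX ⟩
    gᴷ X     ≤⟨ gᴷX≤gW ⟩
    g W      ≤⟨ d-≥ eW (X⊆W u∈X) ⟩
    d F g u  ∎
    where open ≤-Reasoning

  d≤d-reduced : ∀ {P u} → IsPart F g P → u ∈ P → Empty (P ∩ K) → d F g u ≤ dᴷ u
  d≤d-reduced {P} {u} partP u∈P P∩K=∅ with d-attained u
  ... | inj₁ d≡1 = ≤-trans (≤-reflexive d≡1) (ℰᴷ.d-≥1 u)
  ... | inj₂ (X , eX , u∈X , d≡gX) = begin
    d F g u  ≡⟨ d≡gX ⟩
    g X      ≤⟨ proj₂ restricted ⟩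
    gᴷ X     ≤⟨ ℰᴷ.d-≥ (proj₁ restricted) u∈X ⟩
    dᴷ u     ∎
    where
    open ≤-Reasoning
    maxP : MaxE P
    maxP = part-meeting-E partP u∈P eX u∈X
    restricted : ℰᴷ.InE X × g X ≤ gᴷ X
    restricted = restrict maxP P∩K=∅ eX (laminar maxP eX (u , x∈p∩q⁺ (u∈X , u∈P)))

  -- If the maximal member P of ℰ containing u meets K, the degree drops:
  -- a lifted W meeting K loses value, and one avoiding K is a proper
  -- subset of P by laminarity.
  d-reduced<d : ∀ {P u k} → MaxE P → u ∈ P → k ∈ P → k ∈ K → dᴷ u < d F g u
  d-reduced<d {P} {u} {k} maxP u∈P k∈P k∈K with ℰᴷ.d-attained u
  ... | inj₁ dᴷ≡1 = begin-strict
    dᴷ u     ≡⟨ dᴷ≡1 ⟩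
    + 1      <⟨ +<+ (ℕₚ.n<1+n 1) ⟩
    + 2      ≤⟨ atLeast2 (proj₁ maxP) ⟩
    g P      ≤⟨ d-≥ (proj₁ maxP) u∈P ⟩
    d F g u  ∎
    where open ≤-Reasoning
  ... | inj₂ (X , eᴷX , u∈X , dᴷ≡gᴷX) with lift eᴷX
  ...   | W , eW , X⊆W , gᴷX≤gW , strict-if-meets with nonempty? (W ∩ K)
  ...     | yes W∩K≠∅ = begin-strict
    dᴷ u     ≡⟨ dᴷ≡gᴷX ⟩
    gᴷ X     <⟨ strict-if-meets W∩K≠∅ ⟩
    g W      ≤⟨ d-≥ eW (X⊆W u∈X) ⟩
    d F g u  ∎
    where open ≤-Reasoning
  ...     | no W∩K=∅ = begin-strict
    dᴷ u     ≡⟨ dᴷ≡gᴷX ⟩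
    gᴷ X     ≤⟨ gᴷX≤gW ⟩
    g W      <⟨ minimal (proj₁ maxP) W (member eW) W⊂P ⟩
    g P      ≤⟨ d-≥ (proj₁ maxP) u∈P ⟩
    d F g u  ∎
    where
    open ≤-Reasoning
    W⊂P : W ⊂ P
    W⊂P = laminar maxP eW (u , x∈p∩q⁺ (X⊆W u∈X , u∈P)) , k , k∈P ,
          λ k∈W → W∩K=∅ (k , x∈p∩q⁺ (k∈W , k∈K))

proposition15 : ∀ {n : ℕ} (F : Family n) (g : Subset n → ℤ) →
    IsIntersectingSupermodular F g →
    (∀ (Z : Subset n) → F Z ≡ true → g Z ≤ + ∣ Z ∣) →
    (K : Subset n) → IsPartialTransversal F g K →
    (u : Fin n) → u ∉ K →
    (P : Subset n) → IsPart F g P → u ∈ P →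
    (Empty (P ∩ K) → d (FK F K) (gK F g K) u ≡ d F g u) ×
    (Nonempty (P ∩ K) → d (FK F K) (gK F g K) u < d F g u)
proposition15 F g sm bounded K transversal u u∉K P partP u∈P = unchanged , drops
  where
  open Proposition F g sm bounded K transversal
  open Critical F g using (part-two-points)
  unchanged : Empty (P ∩ K) → dᴷ u ≡ d F g u
  unchanged P∩K=∅ = ≤-antisym (d-reduced≤d u) (d≤d-reduced partP u∈P P∩K=∅)
  -- A part meeting K at k besides u ∉ K has two points, so it is a maximal member of ℰ.
  drops : Nonempty (P ∩ K) → dᴷ u < d F g u
  drops (k , k∈P∩K) with x∈p∩q⁻ P K k∈P∩K
  ... | k∈P , k∈K = d-reduced<d (part-two-points partP u∈P k∈P u≢k) u∈P k∈P k∈K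
    where
    u≢k : u ≢ k
    u≢k refl = u∉K k∈K
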